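{- Let $k\ge 1$. The poset $\mathbf{B}_{k+1}-\{[k+1]\}$ (the Boolean lattice $\mathbf{B}_{k+1}$ with its top element $[k+1]$ removed, with the induced inclusion order) is the unique minimal $(\mathbf{V}_{1,1};k)$-Ramsey poset.
   Context: The Boolean lattice $\mathbf{B}_N$ is the poset $(2^{[N]},\subseteq)$ of all subsets of $[N]=\{1,\dots,N\}$ ordered by inclusion. A poset $\mathbf{Q}$ contains a poset $\mathbf{P}$ as a subposet if there is an injection $\phi$ from the elements of $\mathbf{P}$ to those of $\mathbf{Q}$ with $x\le_{\mathbf{P}} y$ if and only if $\phi(x)\le_{\mathbf{Q}}\phi(y)$. $\mathbf{V}_{1,1}$ is the three-element poset $\{x,y,z\}$ with $x<y$, $x<z$, and $y,z$ incomparable. For posets $\mathbf{P}_1,\dots,\mathbf{P}_k$, $R(\mathbf{P}_1,\dots,\mathbf{P}_k)$ is the minimum $N$ such that for every coloring $c:2^{[N]}\to[k]$, there is some $i$ such that $\mathbf{B}_N$ contains a subposet isomorphic to $\mathbf{P}_i$ all of whose elements have color $i$; it is known that $R(\mathbf{V}_{1,1},\dots,\mathbf{V}_{1,1})=k+1$ ($k$ copies). Let $n=R(\mathbf{P}_1,\dots,\mathbf{P}_k)$. A subposet $\mathbf{Q}\subseteq\mathbf{B}_n$ (with induced order) is called minimal $(\mathbf{P}_1,\dots,\mathbf{P}_k)$-Ramsey if every coloring of the elements of $\mathbf{Q}$ with colors $[k]$ yields, for some $i$, a subposet of $\mathbf{Q}$ isomorphic to $\mathbf{P}_i$ with all elements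 of color $i$, but for every subposet $\mathbf{Q}'\subset\mathbf{Q}$ with $|\mathbf{Q}'|=|\mathbf{Q}|-1$ there is a $k$-coloring of $\mathbf{Q}'$ with no such monochromatic $\mathbf{P}_i$ of color $i$ for any $i$. When all $\mathbf{P}_i=\mathbf{P}$, this is called minimal $(\mathbf{P};k)$-Ramsey. -}

module Defs where

open import Data.Nat using (ℕ)
open import Data.Fin using (Fin)
open import Data.Fin.Subset using (Subset; _⊆_)
open import Data.Product using (Σ; _×_; ∃-syntax)
open import Relation.Binary.PropositionalEquality using (_≡_; _≢_)
open import Relation.Nullary using (¬_)

-- Elements of the Boolean lattice B_n are subsets of [n] (Subset n = Vec Bool n),
-- ordered by inclusion _⊆_.
-- A subposet Q of B_n is given by its membership predicate (induced order).
SubPoset : ℕ → Set₁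
SubPoset n = Subset n → Set

-- A k-colouring of Q: a map to Fin k (values outside Q are irrelevant).
Colouring : ℕ → ℕ → Set
Colouring n k = Subset n → Fin k

-- Q contains, under colouring c, a monochromatic induced copy of V_{1,1}:
-- distinct x,y,z ∈ Q with x < y, x < z, y and z incomparable, all the same colour.
-- (With all P_i = V_{1,1}, "colour i copy of P_i for some i" is exactly this.)
HasMonoV : ∀ {n k} → SubPoset n → Colouring n k → Set
HasMonoV {n} Q c =
  ∃[ x ] ∃[ y ] ∃[ z ]
    (Q x × Q y × Q z ×
     x ⊆ y × x ≢ y × x ⊆ z × x ≢ z × ¬ (y ⊆ z) × ¬ (z ⊆ y) ×
     c x ≡ c y × c x ≡ c z)

Ramsey : ∀ {n} (k : ℕ) → SubPoset n → Set
Ramsey {n} k Q = (c : Colouring n k) → HasMonoV Q c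

Remove : ∀ {n} → SubPoset n → Subset n → SubPoset n
Remove Q a x = Q x × x ≢ a

-- Minimal (V_{1,1};k)-Ramsey: Ramsey, and every Q' ⊂ Q with |Q'| = |Q| - 1
-- (i.e. Q minus one of its elements) has a k-colouring with no monochromatic V_{1,1}.
MinimalRamsey : ∀ {n} (k : ℕ) → SubPoset n → Set
MinimalRamsey {n} k Q =
  Ramsey k Q ×
  ((a : Subset n) → Q a → Σ (Colouring n k) (λ c → ¬ HasMonoV (Remove Q a) c))

-- Ramsey property: if a k-colouring of B_{k+1} − {[k+1]} had no monochromatic V, the non-top
-- supersets of a non-top s coloured like s would form a chain; since a chain of non-top sets cannot
-- cover every point, some e lies in none of them, so no non-top superset of s ∪ {e} has the colour
-- of s. Starting from ∅, each such step adds one point and retires one colour, so after at most k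
-- steps a non-top set is reached whose non-top supersets, itself included, have no colour left.
--
-- Minimality: a V never contains the top, so [k+1] cannot belong to a minimal Ramsey poset. For
-- a ≠ [k+1], colour B_{k+1} − {[k+1], a} by |x| − 1 on sets x ⊋ a, by the number of points of a
-- below g on the coatoms [k+1] − {g} with g ∈ a (a number below |a|), and by |x| elsewhere. Colours
-- strictly increase along sets containing a. Above an x ⊉ a, a set of the colour of x is either a
-- cover of x containing a or such a coatom: two covers would meet in x and force a ⊆ x, two
-- coatoms would miss the same point, and a cover has more than |a| points while the coatom's colour
-- is below |a|. So no B_{k+1} − {[k+1], a} is Ramsey, which gives both minimality and uniqueness.

module Submission where

open import Defs
open import Data.Nat using (ℕ; suc; _≤_)
open import Data.Fin.Subset using (Subset; ⊤)
open import Relation.Binary.PropositionalEquality using (_≢_)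
open import Function.Bundles using (_⇔_)

open import Data.Nat as ℕ using (zero; _<_; _+_; pred; z≤n; s≤s; NonZero; >-nonZero)
open import Data.Nat.Properties
  using (≤-trans; ≤-reflexive; <-≤-trans; ≤-<-trans; ≤∧≢⇒<; <-irrefl; ≤-pred;
         m≤m+n; +-suc; +-monoˡ-≤; +-monoʳ-≤; pred-mono-≤; pred-mono-<; suc-pred;
         <⇒≱; n<1+n; suc-injective; <⇒≢; module ≤-Reasoning)
open import Data.Nat.DivMod using (_mod_; _%_; m<n⇒m%n≡m)
import Data.Bool as Bool
open import Data.Vec using ([]; _∷_; here; there)
open import Data.Vec.Properties using (≡-dec)
open import Data.Fin using (Fin; zero; suc; toℕ)
open import Data.Fin.Properties using (toℕ-fromℕ<; all?; ¬∀⟶∃¬)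
import Data.Fin.Properties as Fin
open import Data.Fin.Subset
  using (_∈_; _∉_; _⊆_; _∪_; _∩_; _-_; ∁; ⁅_⁆; ∣_∣; inside; outside)
  renaming (⊥ to ∅)
open import Data.Fin.Subset.Properties
  using (_⊆?_; _∈?_; anySubset?; drop-∷-⊆; p⊆q⇒∣p∣≤∣q∣; ∣p∣≤n; ∣p∣≤∣x∷p∣; ∣p∣≡n⇒p≡⊤;
         ∣⊤∣≡n; ∣⊥∣≡0; ∣⁅x⁆∣≡1; ∣∁p∣≡n∸∣p∣; ∈⊤; ⊆⊤; ⊆-antisym; ⊆-refl; ⊆-trans; ⊆-reflexive;
         x∈⁅x⁆; x∈⁅y⁆⇒x≡y; x∉p⇒x∈∁p; x≢y⇒x∉⁅y⁆;
         p∩q⊆p; p∩q⊆q; x∈p∩q⁺; p⊆p∪q; q⊆p∪q; x∈p∧x≢y⇒x∈p-y; x∈p⇒∣p-x∣<∣p∣)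
open import Data.List using (List; []; _∷_; allFin)
open import Data.List.Relation.Unary.All as All using (All; []; _∷_)
open import Data.List.Membership.Propositional.Properties using (∈-allFin)
open import Data.Product using (∃; _×_; _,_; proj₁; proj₂)
open import Data.Sum using (_⊎_; inj₁; inj₂)
open import Data.Empty using (⊥; ⊥-elim)
open import Relation.Nullary using (¬_; Dec; yes; no; contradiction)
open import Relation.Nullary.Decidable using (_×-dec_; ¬?)
open import Relation.Binary.Definitions using (DecidableEquality)
open import Relation.Binary.PropositionalEquality
  using (_≡_; refl; sym; trans; cong; cong₂; subst; subst₂; module ≡-Reasoning)
open import Function.Bundles using (mk⇔; Equivalence)

private
  variable
    n k : ℕ
    p q x y z : Subset n

_≟ₛ_ : DecidableEquality (Subset n)
_≟ₛ_ = ≡-dec Bool._≟_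

p⊆q∧∣q∣≤∣p∣⇒p≡q : p ⊆ q → ∣ q ∣ ≤ ∣ p ∣ → p ≡ q
p⊆q∧∣q∣≤∣p∣⇒p≡q {p = []}          {[]}          _   _ = refl
p⊆q∧∣q∣≤∣p∣⇒p≡q {p = outside ∷ p} {outside ∷ q} p⊆q ∣q∣≤∣p∣ =
  cong (outside ∷_) (p⊆q∧∣q∣≤∣p∣⇒p≡q (drop-∷-⊆ p⊆q) ∣q∣≤∣p∣)
p⊆q∧∣q∣≤∣p∣⇒p≡q {p = outside ∷ p} {inside ∷ q}  p⊆q ∣q∣≤∣p∣ =
  contradiction (p⊆q⇒∣p∣≤∣q∣ (drop-∷-⊆ p⊆q)) (<⇒≱ ∣q∣≤∣p∣)
p⊆q∧∣q∣≤∣p∣⇒p≡q {p = inside ∷ p}  {outside ∷ q} p⊆q _ with p⊆q here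
... | ()
p⊆q∧∣q∣≤∣p∣⇒p≡q {p = inside ∷ p}  {inside ∷ q}  p⊆q ∣q∣≤∣p∣ =
  cong (inside ∷_) (p⊆q∧∣q∣≤∣p∣⇒p≡q (drop-∷-⊆ p⊆q) (≤-pred ∣q∣≤∣p∣))

p⊆q∧p≢q⇒∣p∣<∣q∣ : p ⊆ q → p ≢ q → ∣ p ∣ < ∣ q ∣
p⊆q∧p≢q⇒∣p∣<∣q∣ p⊆q p≢q = ≤∧≢⇒< (p⊆q⇒∣p∣≤∣q∣ p⊆q)
  (λ ∣p∣≡∣q∣ → p≢q (p⊆q∧∣q∣≤∣p∣⇒p≡q p⊆q (≤-reflexive (sym ∣p∣≡∣q∣))))

p≢⊤⇒∣p∣<n : {p : Subset n} → p ≢ ⊤ → ∣ p ∣ < n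
p≢⊤⇒∣p∣<n {p = p} p≢⊤ = ≤∧≢⇒< (∣p∣≤n p) (λ ∣p∣≡n → p≢⊤ (∣p∣≡n⇒p≡⊤ ∣p∣≡n))

∣p∪q∣≤∣p∣+∣q∣ : ∀ (p q : Subset n) → ∣ p ∪ q ∣ ≤ ∣ p ∣ + ∣ q ∣
∣p∪q∣≤∣p∣+∣q∣ []            []            = z≤n
∣p∪q∣≤∣p∣+∣q∣ (inside ∷ p)  (b ∷ q)       =
  s≤s (≤-trans (∣p∪q∣≤∣p∣+∣q∣ p q) (+-monoʳ-≤ ∣ p ∣ (∣p∣≤∣x∷p∣ b q)))
∣p∪q∣≤∣p∣+∣q∣ (outside ∷ p) (inside ∷ q)  =
  ≤-trans (s≤s (∣p∪q∣≤∣p∣+∣q∣ p q)) (≤-reflexive (sym (+-suc ∣ p ∣ ∣ q ∣)))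
∣p∪q∣≤∣p∣+∣q∣ (outside ∷ p) (outside ∷ q) = ∣p∪q∣≤∣p∣+∣q∣ p q

cover∧⊈⇒≡∩ : x ⊆ y → x ⊆ z → ¬ y ⊆ z → ∣ y ∣ ≡ suc ∣ x ∣ → x ≡ y ∩ z
cover∧⊈⇒≡∩ {x = x} {y} {z} x⊆y x⊆z y⊈z ∣y∣≡1+∣x∣ =
  p⊆q∧∣q∣≤∣p∣⇒p≡q (λ i∈x → x∈p∩q⁺ (x⊆y i∈x , x⊆z i∈x))
    (≤-pred (subst (∣ y ∩ z ∣ <_) ∣y∣≡1+∣x∣ ∣y∩z∣<∣y∣))
  where
  ∣y∩z∣<∣y∣ : ∣ y ∩ z ∣ < ∣ y ∣
  ∣y∩z∣<∣y∣ = p⊆q∧p≢q⇒∣p∣<∣q∣ (p∩q⊆p y z)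
    (λ y∩z≡y → y⊈z (subst (_⊆ z) y∩z≡y (p∩q⊆q y z)))

-- The first point outside p; zero when there is none.
gap : Subset (suc n) → Fin (suc n)
gap (outside ∷ _)          = zero
gap (inside ∷ [])          = zero
gap (inside ∷ p@(_ ∷ _))   = suc (gap p)

gap∉ : {p : Subset (suc n)} → p ≢ ⊤ → gap p ∉ p
gap∉ {p = outside ∷ _}        _   ()
gap∉ {p = inside ∷ []}        p≢⊤ = contradiction refl p≢⊤
gap∉ {p = inside ∷ p@(_ ∷ _)} p≢⊤ (there g∈p) = gap∉ (λ p≡⊤ → p≢⊤ (cong (inside ∷_) p≡⊤)) g∈p

∣∁⁅i⁆∣≡n : (i : Fin (suc n)) → ∣ ∁ ⁅ i ⁆ ∣ ≡ n
∣∁⁅i⁆∣≡n {n} i = trans (∣∁p∣≡n∸∣p∣ ⁅ i ⁆) (cong (suc n ℕ.∸_) (∣⁅x⁆∣≡1 i))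

coatom≡∁⁅⁆ : {p : Subset (suc n)} {i : Fin (suc n)} → ∣ p ∣ ≡ n → i ∉ p → p ≡ ∁ ⁅ i ⁆
coatom≡∁⁅⁆ {p = p} {i} ∣p∣≡n i∉p =
  p⊆q∧∣q∣≤∣p∣⇒p≡q p⊆∁⁅i⁆ (≤-reflexive (trans (∣∁⁅i⁆∣≡n i) (sym ∣p∣≡n)))
  where
  p⊆∁⁅i⁆ : p ⊆ ∁ ⁅ i ⁆
  p⊆∁⁅i⁆ j∈p = x∉p⇒x∈∁p (λ j∈⁅i⁆ → i∉p (subst (_∈ p) (x∈⁅y⁆⇒x≡y i j∈⁅i⁆) j∈p))

coatom≡∁⁅gap⁆ : {p : Subset (suc n)} → ∣ p ∣ ≡ n → p ≡ ∁ ⁅ gap p ⁆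
coatom≡∁⁅gap⁆ {p = p} ∣p∣≡n = coatom≡∁⁅⁆ ∣p∣≡n (gap∉ p≢⊤)
  where
  p≢⊤ : p ≢ ⊤
  p≢⊤ p≡⊤ = <-irrefl (trans (sym ∣p∣≡n) (trans (cong ∣_∣ p≡⊤) (∣⊤∣≡n _))) (n<1+n _)

position : Subset n → Fin n → ℕ
position (_ ∷ _)       zero    = 0
position (inside ∷ p)  (suc i) = suc (position p i)
position (outside ∷ p) (suc i) = position p i

position<∣p∣ : {i : Fin n} → i ∈ p → position p i < ∣ p ∣
position<∣p∣ {p = inside ∷ _}  here        = s≤s z≤n
position<∣p∣ {p = inside ∷ _}  (there i∈p) = s≤s (position<∣p∣ i∈p)
position<∣p∣ {p = outside ∷ _} (there i∈p) = position<∣p∣ i∈p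

position-injective : {i j : Fin n} → i ∈ p → j ∈ p → position p i ≡ position p j → i ≡ j
position-injective {p = inside ∷ _}  here        here        _ = refl
position-injective {p = inside ∷ _}  (there i∈p) (there j∈p) e =
  cong suc (position-injective i∈p j∈p (suc-injective e))
position-injective {p = outside ∷ _} (there i∈p) (there j∈p) e =
  cong suc (position-injective i∈p j∈p e)

mod-injective : ∀ {m m′} .{{_ : NonZero n}} → m < n → m′ < n → m mod n ≡ m′ mod n → m ≡ m′
mod-injective {n} {m} {m′} m<n m′<n eq = begin
  m                ≡⟨ sym (m<n⇒m%n≡m m<n) ⟩
  m % n            ≡⟨ sym (toℕ-fromℕ< _) ⟩
  toℕ (m mod n)    ≡⟨ cong toℕ eq ⟩
  toℕ (m′ mod n)   ≡⟨ toℕ-fromℕ< _ ⟩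
  m′ % n           ≡⟨ m<n⇒m%n≡m m′<n ⟩
  m′               ∎
  where open ≡-Reasoning

chain-upper-bound : {F : Subset n → Set} → (∀ {u v} → F u → F v → u ⊆ v ⊎ v ⊆ u) → F p →
                    (is : List (Fin n)) → All (λ i → ∃ λ w → F w × i ∈ w) is →
                    ∃ λ w → F w × All (_∈ w) is
chain-upper-bound _          Fp []       []                      = _ , Fp , []
chain-upper-bound comparable Fp (i ∷ is) ((u , Fu , i∈u) ∷ is∈)
  with chain-upper-bound comparable Fp is is∈
... | w , Fw , is⊆w with comparable Fu Fw
...   | inj₁ u⊆w = w , Fw , u⊆w i∈u ∷ is⊆w
...   | inj₂ w⊆u = u , Fu , i∈u ∷ All.map w⊆u is⊆w

covering-chain∋⊤ : {F : Subset n → Set} → (∀ {u v} → F u → F v → u ⊆ v ⊎ v ⊆ u) → F p →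
                   (∀ i → ∃ λ w → F w × i ∈ w) → ∃ λ w → F w × w ≡ ⊤
covering-chain∋⊤ comparable Fp covered =
  let w , Fw , all∈w = chain-upper-bound comparable Fp (allFin _) (All.tabulate λ {i} _ → covered i)
  in  w , Fw , ⊆-antisym ⊆⊤ (λ {i} _ → All.lookup all∈w (∈-allFin i))

HasMonoV-mono : {Q Q′ : SubPoset n} {c : Colouring n k} → (∀ {w} → Q w → Q′ w) →
                HasMonoV Q c → HasMonoV Q′ c
HasMonoV-mono Q⊆Q′ (x , y , z , Qx , Qy , Qz , V) = x , y , z , Q⊆Q′ Qx , Q⊆Q′ Qy , Q⊆Q′ Qz , V

HasMonoV? : {Q : SubPoset n} → (∀ w → Dec (Q w)) → (c : Colouring n k) → Dec (HasMonoV Q c)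
HasMonoV? Q? c = anySubset? λ x → anySubset? λ y → anySubset? λ z →
  Q? x ×-dec Q? y ×-dec Q? z ×-dec
  x ⊆? y ×-dec ¬? (x ≟ₛ y) ×-dec x ⊆? z ×-dec ¬? (x ≟ₛ z) ×-dec ¬? (y ⊆? z) ×-dec ¬? (z ⊆? y) ×-dec
  c x Fin.≟ c y ×-dec c x Fin.≟ c z

HasMonoV-avoids-⊤ : {Q : SubPoset n} {c : Colouring n k} → HasMonoV Q c → HasMonoV (Remove Q ⊤) c
HasMonoV-avoids-⊤ (x , y , z , Qx , Qy , Qz , x⊆y , x≢y , x⊆z , x≢z , y⊈z , z⊈y , same) =
  x , y , z , (Qx , x≢⊤) , (Qy , y≢⊤) , (Qz , z≢⊤) , x⊆y , x≢y , x⊆z , x≢z , y⊈z , z⊈y , same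
  where
  x≢⊤ : x ≢ ⊤
  x≢⊤ refl = x≢y (⊆-antisym x⊆y ⊆⊤)
  y≢⊤ : y ≢ ⊤
  y≢⊤ refl = z⊈y ⊆⊤
  z≢⊤ : z ≢ ⊤
  z≢⊤ refl = y⊈z ⊆⊤

HasMonoV-avoids-or-hits : {Q : SubPoset n} {c : Colouring n k} (a : Subset n) →
                          HasMonoV Q c → HasMonoV (Remove Q a) c ⊎ Q a
HasMonoV-avoids-or-hits a (x , y , z , Qx , Qy , Qz , V) with x ≟ₛ a | y ≟ₛ a | z ≟ₛ a
... | yes refl | _        | _        = inj₂ Qx
... | no _     | yes refl | _        = inj₂ Qy
... | no _     | no _     | yes refl = inj₂ Qz
... | no x≢a   | no y≢a   | no z≢a   = inj₁ (x , y , z , (Qx , x≢a) , (Qy , y≢a) , (Qz , z≢a) , V)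

NonTop : SubPoset n
NonTop x = x ≢ ⊤

module UpperBound (c : Colouring (suc k) k) (noV : ¬ HasMonoV NonTop c) where

  SameColourAbove : Subset (suc k) → Subset (suc k) → Set
  SameColourAbove s w = s ⊆ w × w ≢ ⊤ × c w ≡ c s

  same-colour-above-comparable : {s u v : Subset (suc k)} → s ≢ ⊤ →
    SameColourAbove s u → SameColourAbove s v → u ⊆ v ⊎ v ⊆ u
  same-colour-above-comparable {s} {u} {v} s≢⊤ (s⊆u , u≢⊤ , cu≡cs) (s⊆v , v≢⊤ , cv≡cs)
    with u ⊆? v | v ⊆? u
  ... | yes u⊆v | _       = inj₁ u⊆v
  ... | no _    | yes v⊆u = inj₂ v⊆u
  ... | no u⊈v  | no v⊈u  =
    ⊥-elim (noV (s , u , v , s≢⊤ , u≢⊤ , v≢⊤ , s⊆u , s≢u , s⊆v , s≢v , u⊈v , v⊈u ,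
                 sym cu≡cs , sym cv≡cs))
    where
    s≢u : s ≢ u
    s≢u refl = u⊈v s⊆v
    s≢v : s ≢ v
    s≢v refl = v⊈u s⊆u

  covered? : ∀ s e → Dec (∃ λ w → SameColourAbove s w × e ∈ w)
  covered? s e = anySubset? λ w → (s ⊆? w ×-dec ¬? (w ≟ₛ ⊤) ×-dec c w Fin.≟ c s) ×-dec e ∈? w

  escape : {s : Subset (suc k)} → s ≢ ⊤ →
           ∃ λ e → ∀ {w} → s ⊆ w → e ∈ w → w ≢ ⊤ → c w ≢ c s
  escape {s} s≢⊤ with all? (covered? s)
  ... | yes covered =
    let w , (_ , w≢⊤ , _) , w≡⊤ =
          covering-chain∋⊤ (same-colour-above-comparable s≢⊤) (⊆-refl , s≢⊤ , refl) covered
    in ⊥-elim (w≢⊤ w≡⊤)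
  ... | no ¬covered with ¬∀⟶∃¬ _ _ (covered? s) ¬covered
  ...   | e , uncovered = e , λ s⊆w e∈w w≢⊤ cw≡cs → uncovered (_ , (s⊆w , w≢⊤ , cw≡cs) , e∈w)

  -- t only bounds ∣ C ∣, to make the descent structurally recursive.
  supersets-need-colours : ∀ t {s} {C : Subset k} → ∣ C ∣ ≤ t →
    (∀ {w} → s ⊆ w → w ≢ ⊤ → c w ∈ C) → suc k ≤ ∣ s ∣ + ∣ C ∣
  supersets-need-colours t {s} ∣C∣≤t colours with s ≟ₛ ⊤
  ... | yes refl = ≤-trans (≤-reflexive (sym (∣⊤∣≡n _))) (m≤m+n _ _)
  supersets-need-colours zero ∣C∣≤0 colours | no s≢⊤ =
    contradiction (<-≤-trans (x∈p⇒∣p-x∣<∣p∣ (colours ⊆-refl s≢⊤)) ∣C∣≤0) λ ()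
  supersets-need-colours (suc t) {s} {C} ∣C∣≤1+t colours | no s≢⊤ = begin
    suc k                          ≤⟨ supersets-need-colours t ∣C-cs∣≤t colours′ ⟩
    ∣ ⁅ e ⁆ ∪ s ∣ + ∣ C - c s ∣     ≤⟨ +-monoˡ-≤ ∣ C - c s ∣ (∣p∪q∣≤∣p∣+∣q∣ ⁅ e ⁆ s) ⟩
    ∣ ⁅ e ⁆ ∣ + ∣ s ∣ + ∣ C - c s ∣ ≡⟨ cong (λ m → m + ∣ s ∣ + ∣ C - c s ∣) (∣⁅x⁆∣≡1 e) ⟩
    suc ∣ s ∣ + ∣ C - c s ∣         ≡⟨ sym (+-suc ∣ s ∣ ∣ C - c s ∣) ⟩
    ∣ s ∣ + suc ∣ C - c s ∣         ≤⟨ +-monoʳ-≤ ∣ s ∣ ∣C-cs∣<∣C∣ ⟩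
    ∣ s ∣ + ∣ C ∣                   ∎
    where
    open ≤-Reasoning
    e : Fin (suc k)
    e = proj₁ (escape s≢⊤)
    ∣C-cs∣<∣C∣ : ∣ C - c s ∣ < ∣ C ∣
    ∣C-cs∣<∣C∣ = x∈p⇒∣p-x∣<∣p∣ (colours ⊆-refl s≢⊤)
    ∣C-cs∣≤t : ∣ C - c s ∣ ≤ t
    ∣C-cs∣≤t = ≤-pred (<-≤-trans ∣C-cs∣<∣C∣ ∣C∣≤1+t)
    colours′ : ∀ {w} → ⁅ e ⁆ ∪ s ⊆ w → w ≢ ⊤ → c w ∈ C - c s
    colours′ {w} e∪s⊆w w≢⊤ = x∈p∧x≢y⇒x∈p-y (colours s⊆w w≢⊤) (proj₂ (escape s≢⊤) s⊆w e∈w w≢⊤)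
      where
      s⊆w : s ⊆ w
      s⊆w i∈s = e∪s⊆w (q⊆p∪q ⁅ e ⁆ s i∈s)
      e∈w : e ∈ w
      e∈w = e∪s⊆w (p⊆p∪q s (x∈⁅x⁆ e))

  impossible : ⊥
  impossible = <-irrefl refl (subst (suc k ≤_) ∣∅∣+∣⊤∣≡k
    (supersets-need-colours k {∅} (≤-reflexive (∣⊤∣≡n k)) (λ _ _ → ∈⊤)))
    where
    ∣∅∣+∣⊤∣≡k : ∣ ∅ {suc k} ∣ + ∣ ⊤ {k} ∣ ≡ k
    ∣∅∣+∣⊤∣≡k = cong₂ _+_ (∣⊥∣≡0 (suc k)) (∣⊤∣≡n k)

nonTop-Ramsey : (c : Colouring (suc k) k) → HasMonoV NonTop c
nonTop-Ramsey c with HasMonoV? (λ w → ¬? (w ≟ₛ ⊤)) c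
... | yes V   = V
... | no noV = ⊥-elim (UpperBound.impossible c noV)

module LowerBound .{{_ : NonZero k}} (a : Subset (suc k)) (a≢⊤ : a ≢ ⊤) where

  colourIndex : Subset (suc k) → ℕ
  colourIndex x with a ⊆? x | ∣ x ∣ ℕ.≟ k
  ... | yes _ | _     = pred ∣ x ∣
  ... | no _  | yes _ = position a (gap x)
  ... | no _  | no _  = ∣ x ∣

  colouring : Colouring (suc k) k
  colouring x = colourIndex x mod k

  colourIndex-⊇a : {x : Subset (suc k)} → a ⊆ x → colourIndex x ≡ pred ∣ x ∣
  colourIndex-⊇a {x} a⊆x with a ⊆? x
  ... | yes _   = refl
  ... | no a⊈x = ⊥-elim (a⊈x a⊆x)

  colourIndex-coatom : {x : Subset (suc k)} → ¬ a ⊆ x → ∣ x ∣ ≡ k →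
                       colourIndex x ≡ position a (gap x)
  colourIndex-coatom {x} a⊈x ∣x∣≡k with a ⊆? x | ∣ x ∣ ℕ.≟ k
  ... | yes a⊆x | _         = ⊥-elim (a⊈x a⊆x)
  ... | no _    | yes _     = refl
  ... | no _    | no ∣x∣≢k = ⊥-elim (∣x∣≢k ∣x∣≡k)

  colourIndex-rank : {x : Subset (suc k)} → ¬ a ⊆ x → ∣ x ∣ ≢ k → colourIndex x ≡ ∣ x ∣
  colourIndex-rank {x} a⊈x ∣x∣≢k with a ⊆? x | ∣ x ∣ ℕ.≟ k
  ... | yes a⊆x | _         = ⊥-elim (a⊈x a⊆x)
  ... | no _    | yes ∣x∣≡k = ⊥-elim (∣x∣≢k ∣x∣≡k)
  ... | no _    | no _      = refl

  gap∈a : {x : Subset (suc k)} → ¬ a ⊆ x → ∣ x ∣ ≡ k → gap x ∈ a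
  gap∈a {x} a⊈x ∣x∣≡k with gap x ∈? a
  ... | yes gap∈a = gap∈a
  ... | no gap∉a  = ⊥-elim (a⊈x a⊆x)
    where
    a⊆x : a ⊆ x
    a⊆x i∈a = subst (_ ∈_) (sym (coatom≡∁⁅gap⁆ ∣x∣≡k))
      (x∉p⇒x∈∁p (x≢y⇒x∉⁅y⁆ λ i≡gap → gap∉a (subst (_∈ a) i≡gap i∈a)))

  colourIndex<k : {x : Subset (suc k)} → x ≢ ⊤ → colourIndex x < k
  colourIndex<k {x} x≢⊤ with a ⊆? x | ∣ x ∣ ℕ.≟ k
  ... | yes _    | _         = ≤-<-trans (pred-mono-≤ ∣x∣≤k) pred[k]<k
    where
    ∣x∣≤k : ∣ x ∣ ≤ k
    ∣x∣≤k = ≤-pred (p≢⊤⇒∣p∣<n x≢⊤)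
    pred[k]<k : pred k < k
    pred[k]<k = ≤-reflexive (suc-pred k)
  ... | no a⊈x | yes ∣x∣≡k = <-≤-trans (position<∣p∣ (gap∈a a⊈x ∣x∣≡k)) (≤-pred (p≢⊤⇒∣p∣<n a≢⊤))
  ... | no _     | no ∣x∣≢k = ≤∧≢⇒< (≤-pred (p≢⊤⇒∣p∣<n x≢⊤)) ∣x∣≢k

  colourIndex-injective : {x y : Subset (suc k)} → x ≢ ⊤ → y ≢ ⊤ →
                          colouring x ≡ colouring y → colourIndex x ≡ colourIndex y
  colourIndex-injective x≢⊤ y≢⊤ = mod-injective (colourIndex<k x≢⊤) (colourIndex<k y≢⊤)

  colourIndex-increasing : {x y : Subset (suc k)} → a ⊆ x → x ≢ a → x ⊆ y → x ≢ y →
                           colourIndex x < colourIndex y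
  colourIndex-increasing {x} {y} a⊆x x≢a x⊆y x≢y =
    subst₂ _<_ (sym (colourIndex-⊇a a⊆x)) (sym (colourIndex-⊇a (⊆-trans a⊆x x⊆y)))
      (pred-mono-< {{>-nonZero (≤-<-trans z≤n ∣a∣<∣x∣)}} (p⊆q∧p≢q⇒∣p∣<∣q∣ x⊆y x≢y))
    where
    ∣a∣<∣x∣ : ∣ a ∣ < ∣ x ∣
    ∣a∣<∣x∣ = p⊆q∧p≢q⇒∣p∣<∣q∣ a⊆x (λ a≡x → x≢a (sym a≡x))

  data Mate (x w : Subset (suc k)) : Set where
    cover  : a ⊆ w → ∣ w ∣ ≡ suc ∣ x ∣ → Mate x w
    coatom : ¬ a ⊆ w → ∣ w ∣ ≡ k → position a (gap w) ≡ ∣ x ∣ → Mate x w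

  mate : {x w : Subset (suc k)} → ¬ a ⊆ x → x ⊆ w → x ≢ w → w ≢ ⊤ →
         colourIndex x ≡ colourIndex w → Mate x w
  mate {x} {w} a⊈x x⊆w x≢w w≢⊤ same = classify (a ⊆? w) (∣ w ∣ ℕ.≟ k)
    where
    ∣x∣<∣w∣ : ∣ x ∣ < ∣ w ∣
    ∣x∣<∣w∣ = p⊆q∧p≢q⇒∣p∣<∣q∣ x⊆w x≢w
    ∣x∣≡colourIndex-w : ∣ x ∣ ≡ colourIndex w
    ∣x∣≡colourIndex-w = trans (sym (colourIndex-rank a⊈x ∣x∣≢k)) same
      where
      ∣x∣≢k : ∣ x ∣ ≢ k
      ∣x∣≢k = <⇒≢ (<-≤-trans ∣x∣<∣w∣ (≤-pred (p≢⊤⇒∣p∣<n w≢⊤)))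
    classify : Dec (a ⊆ w) → Dec (∣ w ∣ ≡ k) → Mate x w
    classify (yes a⊆w) _ = cover a⊆w (begin
      ∣ w ∣              ≡⟨ suc-pred ∣ w ∣ {{>-nonZero (≤-<-trans z≤n ∣x∣<∣w∣)}} ⟨
      suc (pred ∣ w ∣)    ≡⟨ cong suc (colourIndex-⊇a a⊆w) ⟨
      suc (colourIndex w) ≡⟨ cong suc ∣x∣≡colourIndex-w ⟨
      suc ∣ x ∣           ∎)
      where open ≡-Reasoning
    classify (no a⊈w) (yes ∣w∣≡k) =
      coatom a⊈w ∣w∣≡k (trans (sym (colourIndex-coatom a⊈w ∣w∣≡k)) (sym ∣x∣≡colourIndex-w))
    classify (no a⊈w) (no ∣w∣≢k) =
      ⊥-elim (<⇒≢ ∣x∣<∣w∣ (trans ∣x∣≡colourIndex-w (colourIndex-rank a⊈w ∣w∣≢k)))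

  cover-coatom-clash : {m : ℕ} {y z : Subset (suc k)} → a ⊆ y → y ≢ a → ∣ y ∣ ≡ suc m →
                       ¬ a ⊆ z → ∣ z ∣ ≡ k → position a (gap z) ≡ m → ⊥
  cover-coatom-clash {m} {y} a⊆y y≢a ∣y∣≡1+m a⊈z ∣z∣≡k position≡m =
    <⇒≱ m<∣a∣ (≤-pred (subst (∣ a ∣ <_) ∣y∣≡1+m ∣a∣<∣y∣))
    where
    m<∣a∣ : m < ∣ a ∣
    m<∣a∣ = subst (_< ∣ a ∣) position≡m (position<∣p∣ (gap∈a a⊈z ∣z∣≡k))
    ∣a∣<∣y∣ : ∣ a ∣ < ∣ y ∣
    ∣a∣<∣y∣ = p⊆q∧p≢q⇒∣p∣<∣q∣ a⊆y (λ a≡y → y≢a (sym a≡y))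

  mates-comparable : {x y z : Subset (suc k)} → ¬ a ⊆ x → y ≢ a → z ≢ a → x ⊆ y → x ⊆ z →
                     Mate x y → Mate x z → ¬ y ⊆ z → ¬ z ⊆ y → ⊥
  mates-comparable a⊈x _ _ x⊆y x⊆z (cover a⊆y ∣y∣≡1+∣x∣) (cover a⊆z _) y⊈z _ =
    a⊈x (subst (a ⊆_) (sym (cover∧⊈⇒≡∩ x⊆y x⊆z y⊈z ∣y∣≡1+∣x∣)) (λ i∈a → x∈p∩q⁺ (a⊆y i∈a , a⊆z i∈a)))
  mates-comparable _ y≢a _ _ _ (cover a⊆y ∣y∣≡1+∣x∣) (coatom a⊈z ∣z∣≡k position≡∣x∣) _ _ =
    cover-coatom-clash a⊆y y≢a ∣y∣≡1+∣x∣ a⊈z ∣z∣≡k position≡∣x∣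
  mates-comparable _ _ z≢a _ _ (coatom a⊈y ∣y∣≡k position≡∣x∣) (cover a⊆z ∣z∣≡1+∣x∣) _ _ =
    cover-coatom-clash a⊆z z≢a ∣z∣≡1+∣x∣ a⊈y ∣y∣≡k position≡∣x∣
  mates-comparable {y = y} {z} _ _ _ _ _ (coatom a⊈y ∣y∣≡k pos-y) (coatom a⊈z ∣z∣≡k pos-z) y⊈z _ =
    y⊈z (⊆-reflexive y≡z)
    where
    open ≡-Reasoning
    y≡z : y ≡ z
    y≡z = begin
      y               ≡⟨ coatom≡∁⁅gap⁆ ∣y∣≡k ⟩
      ∁ ⁅ gap y ⁆     ≡⟨ cong (λ i → ∁ ⁅ i ⁆) gap-y≡gap-z ⟩
      ∁ ⁅ gap z ⁆     ≡⟨ coatom≡∁⁅gap⁆ ∣z∣≡k ⟨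
      z               ∎
      where
      gap-y≡gap-z : gap y ≡ gap z
      gap-y≡gap-z = position-injective (gap∈a a⊈y ∣y∣≡k) (gap∈a a⊈z ∣z∣≡k) (trans pos-y (sym pos-z))

  noMonoV : ¬ HasMonoV (Remove NonTop a) colouring
  noMonoV (x , y , z , (x≢⊤ , x≢a) , (y≢⊤ , y≢a) , (z≢⊤ , z≢a) ,
           x⊆y , x≢y , x⊆z , x≢z , y⊈z , z⊈y , cx≡cy , cx≡cz) = split (a ⊆? x)
    where
    same-y : colourIndex x ≡ colourIndex y
    same-y = colourIndex-injective x≢⊤ y≢⊤ cx≡cy
    same-z : colourIndex x ≡ colourIndex z
    same-z = colourIndex-injective x≢⊤ z≢⊤ cx≡cz
    split : Dec (a ⊆ x) → ⊥
    split (yes a⊆x) = <-irrefl same-y (colourIndex-increasing a⊆x x≢a x⊆y x≢y)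
    split (no a⊈x)  = mates-comparable a⊈x y≢a z≢a x⊆y x⊆z
      (mate a⊈x x⊆y x≢y y≢⊤ same-y) (mate a⊈x x⊆z x≢z z≢⊤ same-z) y⊈z z⊈y

theorem3 : (k : ℕ) → 1 ≤ k → (Q : SubPoset (suc k)) →
    MinimalRamsey k Q ⇔ ((x : Subset (suc k)) → Q x ⇔ (x ≢ ⊤))
theorem3 (suc j) _ Q = mk⇔ minimal⇒nonTop nonTop⇒minimal
  where
  open LowerBound using (colouring; noMonoV)

  minimal⇒nonTop : MinimalRamsey (suc j) Q → (x : Subset (suc (suc j))) → Q x ⇔ (x ≢ ⊤)
  minimal⇒nonTop (ramsey , minimal) x = mk⇔ Q⊆NonTop (NonTop⊆Q x)
    where
    ¬Q⊤ : ¬ Q ⊤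
    ¬Q⊤ Q⊤ = let c , noV = minimal ⊤ Q⊤ in noV (HasMonoV-avoids-⊤ (ramsey c))
    Q⊆NonTop : ∀ {w} → Q w → w ≢ ⊤
    Q⊆NonTop Qw w≡⊤ = ¬Q⊤ (subst Q w≡⊤ Qw)
    NonTop⊆Q : ∀ w → w ≢ ⊤ → Q w
    NonTop⊆Q w w≢⊤ with HasMonoV-avoids-or-hits w (ramsey (colouring w w≢⊤))
    ... | inj₁ V  = ⊥-elim (noMonoV w w≢⊤ (HasMonoV-mono (λ (Qv , v≢w) → Q⊆NonTop Qv , v≢w) V))
    ... | inj₂ Qw = Qw

  nonTop⇒minimal : ((x : Subset (suc (suc j))) → Q x ⇔ (x ≢ ⊤)) → MinimalRamsey (suc j) Q
  nonTop⇒minimal Q⇔NonTop =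
    (λ c → HasMonoV-mono (λ {w} → from (Q⇔NonTop w)) (nonTop-Ramsey c)) ,
    (λ a Qa → colouring a (to (Q⇔NonTop a) Qa) ,
              λ V → noMonoV a (to (Q⇔NonTop a) Qa)
                      (HasMonoV-mono (λ {w} (Qw , w≢a) → to (Q⇔NonTop w) Qw , w≢a) V))
    where open Equivalence
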